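{- For every integer $k \ge 3$ and every integer $n \ge 1$: (1) $c_{n,k} = \alpha(Part_{n,k})$; and (2) $\chi(Part_{n,k})$ is equal to the minimal number of colors needed to color $[k]^n$ so that there is no monochromatic combinatorial line.
   Context: $[m]=\{1,\dots,m\}$. Words: elements of $[k]^n$. A combinatorial line in $[k]^n$ is a set of $k$ distinct words that can be placed as the rows of a $k\times n$ table such that every column of the table belongs to $\{(x,x,\ldots,x): x\in[k]\}\cup\{(1,2,\ldots,k)\}$. The density Hales–Jewett number $c_{n,k}$ is the maximal cardinality of a subset of $[k]^n$ containing no combinatorial line. Number-on-the-forehead setting: for a function $f: X_1\times\cdots\times X_k\to\{0,1\}$, a set $C\subseteq X_1\times\cdots\times X_k$ is a cylinder in the $i$-th coordinate if membership of a tuple in $C$ does not depend on its $i$-th coordinate; a cylinder intersection is a set $C=\bigcap_{i=1}^k C_i$ with $C_i$ a cylinder in the $i$-th coordinate. $\alpha(f)$ is the largest size of a cylinder intersection contained in $f^{ -1}(1)$, and $\chi(f)$ is the least number of cylinder intersections, each contained in $f^{ -1}(1)$, that form a partition of $f^{ -1}(1)$. $Part_{n,k}:(2^{[n]})^k\to\{0,1\}$ is defined by $Part_{n,k}(S_1,\ldots,S_k)=1$ iff $(S_1,\ldots,S_k)$ is a partition of $[n]$ (i.e. the $S_i$ are pairwise disjoint with union $[n]$; empty parts allowed). -}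

module Defs where

open import Data.Nat using (ℕ; _≤_)
open import Data.Fin using (Fin)
open import Data.Vec using (Vec; lookup)
open import Data.Bool using (Bool; true)
open import Data.List using (List; length)
open import Data.List.Membership.Propositional using () renaming (_∈_ to _∈ₗ_)
open import Data.List.Relation.Unary.Unique.Propositional using (Unique)
open import Data.Fin.Subset using (Subset) renaming (_∈_ to _∈ₛ_)
open import Data.Product using (Σ; ∃; _×_)
open import Function.Bundles using (_⇔_)
open import Relation.Binary.PropositionalEquality using (_≡_; _≢_)
open import Relation.Nullary using (¬_)
open import Data.Sum using (_⊎_)
open import Data.Empty using (⊥)

IsMax : (ℕ → Set) → ℕ → Set
IsMax P c = P c × (∀ m → P m → m ≤ c)

IsMin : (ℕ → Set) → ℕ → Set
IsMin P c = P c × (∀ m → P m → c ≤ m)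

-- Words and combinatorial lines.  [k] is modelled by Fin k
-- (value i : Fin k stands for i+1), a word of [k]^n is a Vec (Fin k) n.

Word : ℕ → ℕ → Set
Word k n = Vec (Fin k) n

record IsLine (k n : ℕ) (row : Fin k → Word k n) : Set where
  field
    distinct : ∀ i i' → row i ≡ row i' → i ≡ i'
    columns  : ∀ (j : Fin n) →
                 (∀ i i' → lookup (row i) j ≡ lookup (row i') j)
               ⊎ (∀ i → lookup (row i) j ≡ i)

ContainsLine : (k n : ℕ) → List (Word k n) → Set
ContainsLine k n A = Σ (Fin k → Word k n) λ row → IsLine k n row × (∀ i → row i ∈ₗ A)

LineFreeOfSize : ℕ → ℕ → ℕ → Set
LineFreeOfSize k n m =
  Σ (List (Word k n)) λ A → Unique A × length A ≡ m × ¬ ContainsLine k n A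

LineColorable : ℕ → ℕ → ℕ → Set
LineColorable k n m =
  Σ (Word k n → Fin m) λ col →
    ∀ (row : Fin k → Word k n) → IsLine k n row →
      ¬ (∀ i i' → col (row i) ≡ col (row i'))

Tuple : ℕ → ℕ → Set
Tuple n k = Vec (Subset n) k

Part : (n k : ℕ) → Tuple n k → Set
Part n k S =
  (∀ (i j : Fin k) (x : Fin n) → i ≢ j → x ∈ₛ lookup S i → x ∈ₛ lookup S j → ⊥)
  × (∀ (x : Fin n) → ∃ λ (i : Fin k) → x ∈ₛ lookup S i)

AgreeExcept : ∀ {n k} → Fin k → Tuple n k → Tuple n k → Set
AgreeExcept {k = k} i S T = ∀ (j : Fin k) → j ≢ i → lookup S j ≡ lookup T j

IsCylinder : ∀ {n k} → Fin k → (Tuple n k → Bool) → Set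
IsCylinder i C = ∀ S T → AgreeExcept i S T → C S ≡ C T

record CylInt (n k : ℕ) : Set where
  field
    cyl   : Fin k → Tuple n k → Bool
    isCyl : ∀ i → IsCylinder i (cyl i)

_∈CI_ : ∀ {n k} → Tuple n k → CylInt n k → Set
S ∈CI C = ∀ i → CylInt.cyl C i S ≡ true

CylIntInPartOfSize : ℕ → ℕ → ℕ → Set
CylIntInPartOfSize n k m =
  Σ (CylInt n k) λ C →
    (∀ S → S ∈CI C → Part n k S) ×
    Σ (List (Tuple n k)) λ xs →
      Unique xs × length xs ≡ m × (∀ S → (S ∈CI C) ⇔ (S ∈ₗ xs))

PartCoverOfSize : ℕ → ℕ → ℕ → Set
PartCoverOfSize n k m =
  Σ (Fin m → CylInt n k) λ C →
    (∀ r S → S ∈CI C r → Part n k S) ×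
    (∀ S → Part n k S → ∃ λ r → S ∈CI C r) ×
    (∀ r r' S → S ∈CI C r → S ∈CI C r' → r ≡ r')

-- c_{n,k} , α(Part_{n,k}) , χ(Part_{n,k}) and the line-chromatic number
-- are characterised via IsMax / IsMin of the predicates above.

module Submission where

-- A word w ∈ [k]^n is the same thing as a partition of [n] into k labelled
-- parts, namely its level sets (levelSets, word).  Under this dictionary:
--
--  * Lemma A (noLineInCylInt): a cylinder intersection C ⊆ Part⁻¹(1) never
--    contains the k partitions coming from a combinatorial line.  Deleting
--    the active coordinates of the line gives a tuple that agrees with the
--    i-th partition off coordinate i, hence lies in every cylinder of C, but
--    does not cover [n].
--  * Lemma B (LineFreeCylinders): conversely, for k ≥ 3 the level-set tuples
--    of a line-free set D of words are exactly a cylinder intersection: the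
--    i-th cylinder consists of the tuples agreeing off coordinate i with a
--    member of D, and the witnesses for a tuple S in all k cylinders are the
--    k instantiations of one template, i.e. form a line unless they coincide.
--
-- Lemmas A and B translate line-free sets into cylinder intersections inside
-- Part⁻¹(1) of the same size, and line-free colorings into partitions of
-- Part⁻¹(1) into as many cylinder intersections.  Since all the predicates
-- involved are decidable (words, templates and colorings can be searched
-- exhaustively) the extremal values exist, and the translations show that the
-- two maxima and the two minima coincide.

open import Defs
open import Data.Nat using (ℕ; zero; suc; _+_; _^_; _≤_; _<_; s≤s; s≤s⁻¹)
open import Data.Nat.Properties using (≤∧≢⇒<; ≮⇒≥; anyUpTo?)
open import Data.Nat.Induction using (<-rec)
open import Data.Fin using (Fin; zero; suc; _≟_; funToFin; finToFun)
open import Data.Fin.Properties using (any?; all?; injective⇒≤; finToFun-funToFin)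
open import Data.Fin.Subset using (Subset) renaming (_∈_ to _∈ₛ_)
open import Data.Fin.Subset.Properties using (⊆-antisym) renaming (_∈?_ to _∈ₛ?_)
open import Data.Vec using (Vec; []; _∷_; lookup; tabulate; map; toList; fromList)
open import Data.Vec.Properties using (lookup∘tabulate; lookup-map; length-toList; toList∘fromList)
open import Data.Vec.Properties using ([]=⇒lookup; lookup⇒[]=) renaming (≡-dec to ≡-decVec)
open import Data.Vec.Relation.Binary.Pointwise.Extensional using (ext; Pointwise-≡⇒≡)
open import Data.Bool using (true) renaming (_≟_ to _≟B_)
open import Data.Maybe using (Maybe; just; nothing; fromMaybe)
open import Data.Maybe.Properties using (just-injective) renaming (≡-dec to ≡-decMaybe)
open import Data.List as List using (List; length)
open import Data.List.Properties using (length-map; map-∘; map-id-local)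
open import Data.List.Membership.Propositional using () renaming (_∈_ to _∈ₗ_)
open import Data.List.Membership.Propositional.Properties using (∈-lookup; ∈-map⁺; ∈-map⁻)
import Data.List.Membership.DecPropositional as DecMembership
open import Data.List.Relation.Unary.All as All using ()
open import Data.List.Relation.Unary.AllPairs using ([]; _∷_)
open import Data.List.Relation.Unary.Unique.Propositional using (Unique)
open import Data.List.Relation.Unary.Unique.Propositional.Properties using (map⁺; map⁻)
import Data.List.Relation.Unary.Unique.DecPropositional as DecUnique
open import Data.Product using (Σ; ∃; _×_; _,_; proj₁; proj₂)
open import Data.Sum using (_⊎_; inj₁; inj₂)
open import Data.Empty using (⊥; ⊥-elim)
open import Function using (_∘_)
open import Function.Bundles using (_⇔_; mk⇔; Equivalence)
import Function.Properties.Equivalence as ⇔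
open import Relation.Binary.PropositionalEquality using (_≡_; _≢_; _≗_; refl; sym; trans; cong; subst; module ≡-Reasoning)
open import Relation.Nullary using (¬_; Dec; yes; no; does; ¬?; contradiction)
open import Relation.Nullary.Decidable using (map′; _×-dec_; _⊎-dec_; _→-dec_)
open import Relation.Nullary.Decidable using (decidable-stable; dec-true; does-⇔)
open import Relation.Unary using (Decidable)

open Equivalence using (to; from)

private
  variable
    A : Set
    k n m : ℕ

lookup-ext : {u v : Vec A m} → (∀ i → lookup u i ≡ lookup v i) → u ≡ v
lookup-ext agree = Pointwise-≡⇒≡ (ext agree)

does⇒ : ∀ {P : Set} (P? : Dec P) → does P? ≡ true → P
does⇒ (yes p) _ = p
does⇒ (no _) ()

Searchable : Set → Set₁
Searchable A = ∀ {P : A → Set} → Decidable P → Dec (∃ P)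

search-Fin : Searchable (Fin m)
search-Fin = any?

search-Maybe : Searchable A → Searchable (Maybe A)
search-Maybe search P? =
  map′ (λ { (inj₁ p) → nothing , p ; (inj₂ (a , p)) → just a , p })
       (λ { (nothing , p) → inj₁ p ; (just a , p) → inj₂ (a , p) })
       (P? nothing ⊎-dec search (P? ∘ just))

search-Vec : Searchable A → ∀ m → Searchable (Vec A m)
search-Vec search zero P? = map′ ([] ,_) (λ { ([] , p) → p }) (P? [])
search-Vec search (suc m) P? =
  map′ (λ { (a , v , p) → a ∷ v , p }) (λ { (a ∷ v , p) → a , v , p })
       (search λ a → search-Vec search m (P? ∘ (a ∷_)))

search-∀ : Searchable A → ∀ {P : A → Set} → Decidable P → Dec (∀ a → P a)
search-∀ search P? =
  map′ (λ none a → decidable-stable (P? a) (λ ¬pa → none (a , ¬pa)))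
       (λ all (a , ¬pa) → ¬pa (all a))
       (¬? (search (¬? ∘ P?)))

boundedMaximum : ∀ {P : ℕ → Set} → Decidable P → P 0 →
  ∀ d → (∀ m → P m → m ≤ d) → Σ ℕ (IsMax P)
boundedMaximum P? p0 d bound with P? d
... | yes pd = d , pd , bound
boundedMaximum P? p0 zero bound | no ¬p0 = contradiction p0 ¬p0
boundedMaximum P? p0 (suc d) bound | no ¬pd =
  boundedMaximum P? p0 d λ m pm → s≤s⁻¹ (≤∧≢⇒< (bound m pm) λ { refl → ¬pd pm })

leastElement : ∀ {P : ℕ → Set} → Decidable P → ∀ N → P N → Σ ℕ (IsMin P)
leastElement {P} P? = <-rec (λ N → P N → Σ ℕ (IsMin P)) step
  where
  step : ∀ N → (∀ {m} → m < N → P m → Σ ℕ (IsMin P)) → P N → Σ ℕ (IsMin P)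
  step N smaller pN with anyUpTo? P? N
  ... | yes (m , m<N , pm) = smaller m<N pm
  ... | no none = N , pN , λ m pm → ≮⇒≥ λ m<N → none (m , m<N , pm)

IsMax-transfer : ∀ {P Q : ℕ → Set} {c} →
  (∀ {m} → P m → Q m) → (∀ {m} → Q m → P m) → IsMax P c → IsMax Q c
IsMax-transfer P⇒Q Q⇒P (pc , largest) = P⇒Q pc , λ m qm → largest m (Q⇒P qm)

IsMin-transfer : ∀ {P Q : ℕ → Set} {c} →
  (∀ {m} → P m → Q m) → (∀ {m} → Q m → P m) → IsMin P c → IsMin Q c
IsMin-transfer P⇒Q Q⇒P (pc , least) = P⇒Q pc , λ m qm → least m (Q⇒P qm)

code : Word k n → Fin (k ^ n)
code w = funToFin (lookup w)

decode : Fin (k ^ n) → Word k n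
decode {k} {n} c = tabulate (finToFun {k} {n} c)

decode-code : (w : Word k n) → decode (code w) ≡ w
decode-code w = lookup-ext λ x → trans (lookup∘tabulate _ x) (finToFun-funToFin (lookup w) x)

code-injective : ∀ {w w' : Word k n} → code w ≡ code w' → w ≡ w'
code-injective {w = w} {w'} e = begin
  w                  ≡⟨ decode-code w ⟨
  decode (code w)    ≡⟨ cong decode e ⟩
  decode (code w')   ≡⟨ decode-code w' ⟩
  w'                 ∎
  where open ≡-Reasoning

unique-lookup-injective : ∀ {xs : List A} → Unique xs →
  ∀ i j → List.lookup xs i ≡ List.lookup xs j → i ≡ j
unique-lookup-injective (_ ∷ _) zero zero _ = refl
unique-lookup-injective (x∉xs ∷ _) zero (suc j) e = contradiction e (All.lookup x∉xs (∈-lookup j))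
unique-lookup-injective (x∉xs ∷ _) (suc i) zero e = contradiction (sym e) (All.lookup x∉xs (∈-lookup i))
unique-lookup-injective (_ ∷ u) (suc i) (suc j) e = cong suc (unique-lookup-injective u i j e)

unique-words-length : ∀ {ws : List (Word k n)} → Unique ws → length ws ≤ k ^ n
unique-words-length u = injective⇒≤ λ e → unique-lookup-injective u _ _ (code-injective e)

-- Words are partitions: w ↔ (w⁻¹(1), …, w⁻¹(k))

subset-ext : {p q : Subset n} → (∀ x → x ∈ₛ p ⇔ x ∈ₛ q) → p ≡ q
subset-ext same = ⊆-antisym (λ {x} → to (same x)) (λ {x} → from (same x))

tuple-ext : {S T : Tuple n k} → (∀ i x → x ∈ₛ lookup S i ⇔ x ∈ₛ lookup T i) → S ≡ T
tuple-ext same = lookup-ext λ i → subset-ext (same i)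

tupleOf : {R : Fin n → Fin k → Set} → (∀ x i → Dec (R x i)) → Tuple n k
tupleOf R? = tabulate λ i → tabulate λ x → does (R? x i)

∈-tupleOf : ∀ {R : Fin n → Fin k → Set} (R? : ∀ x i → Dec (R x i)) {x i} →
  x ∈ₛ lookup (tupleOf R?) i ⇔ R x i
∈-tupleOf R? {x} {i} =
  mk⇔ (λ x∈ → does⇒ (R? x i) (trans (sym entry) ([]=⇒lookup x∈)))
      (λ r → lookup⇒[]= x _ (trans entry (dec-true (R? x i) r)))
  where
  entry : lookup (lookup (tupleOf R?) i) x ≡ does (R? x i)
  entry = trans (cong (λ s → lookup s x) (lookup∘tabulate _ i)) (lookup∘tabulate _ x)

levelSets : Word k n → Tuple n k
levelSets w = tupleOf λ x i → lookup w x ≟ i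

∈-levelSets : ∀ (w : Word k n) {x i} → x ∈ₛ lookup (levelSets w) i ⇔ lookup w x ≡ i
∈-levelSets w = ∈-tupleOf (λ x i → lookup w x ≟ i)

levelSets-Part : (w : Word k n) → Part n k (levelSets w)
levelSets-Part w =
  (λ i j x i≢j x∈i x∈j → i≢j (trans (sym (to (∈-levelSets w) x∈i))
                                     (to (∈-levelSets w) x∈j))) ,
  (λ x → lookup w x , from (∈-levelSets w) refl)

levelSets-injective : ∀ {w w' : Word k n} → levelSets w ≡ levelSets w' → w ≡ w'
levelSets-injective {w = w} {w'} e = lookup-ext λ x →
  sym (to (∈-levelSets w') (subst (λ S → x ∈ₛ lookup S (lookup w x)) e
                                  (from (∈-levelSets w) refl)))

Disjoint : Tuple n k → Set
Disjoint {n} {k} S =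
  ∀ (i j : Fin k) (x : Fin n) → i ≢ j → x ∈ₛ lookup S i → x ∈ₛ lookup S j → ⊥

partOf : Tuple n k → Fin n → Maybe (Fin k)
partOf S x with any? (λ i → x ∈ₛ? lookup S i)
... | yes (i , _) = just i
... | no _ = nothing

partOf-just : ∀ (S : Tuple n k) {x i} → partOf S x ≡ just i → x ∈ₛ lookup S i
partOf-just S {x} e with any? (λ i → x ∈ₛ? lookup S i)
... | yes (j , x∈j) = subst (λ i → x ∈ₛ lookup S i) (just-injective e) x∈j
... | no _ = contradiction e λ ()

partOf-nothing : ∀ (S : Tuple n k) {x i} → partOf S x ≡ nothing → ¬ x ∈ₛ lookup S i
partOf-nothing S {x} {i} e with any? (λ i → x ∈ₛ? lookup S i)
... | yes _ = contradiction e λ ()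
... | no none = λ x∈i → none (i , x∈i)

partOf-member : ∀ (S : Tuple n k) {x i} → Disjoint S → x ∈ₛ lookup S i → partOf S x ≡ just i
partOf-member S {x} {i} disjoint x∈i with partOf S x in eq
... | just j = cong just (decidable-stable (j ≟ i) λ j≢i →
                disjoint j i x j≢i (partOf-just S eq) x∈i)
... | nothing = contradiction x∈i (partOf-nothing S eq)

word : Tuple n (suc k) → Word (suc k) n
word S = tabulate λ x → fromMaybe zero (partOf S x)

word-letter : ∀ (S : Tuple n (suc k)) {x j} → Disjoint S → x ∈ₛ lookup S j → lookup (word S) x ≡ j
word-letter S {x} disjoint x∈j =
  trans (lookup∘tabulate (λ x → fromMaybe zero (partOf S x)) x)
        (cong (fromMaybe zero) (partOf-member S disjoint x∈j))

levelSets-word : ∀ {S : Tuple n (suc k)} → Part n (suc k) S → levelSets (word S) ≡ S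
levelSets-word {S = S} (disjoint , covered) = tuple-ext λ i x →
  let (j , x∈j) = covered x
      wx≡j = word-letter S disjoint x∈j
  in mk⇔ (λ x∈i → subst (λ j → x ∈ₛ lookup S j)
                         (trans (sym wx≡j) (to (∈-levelSets (word S)) x∈i)) x∈j)
         (λ x∈i → from (∈-levelSets (word S)) (word-letter S disjoint x∈i))

-- Combinatorial lines as templates

-- A template has a fixed letter (just a) or the variable (nothing) in each
-- coordinate; the coordinates carrying the variable are its stars.
Template : ℕ → ℕ → Set
Template k n = Vec (Maybe (Fin k)) n

instantiate : Template k n → Fin k → Word k n
instantiate t i = map (fromMaybe i) t

HasStar : Template k n → Set
HasStar t = ∃ λ x → lookup t x ≡ nothing

hasStar? : (t : Template k n) → Dec (HasStar t)
hasStar? t = any? λ x → ≡-decMaybe _≟_ (lookup t x) nothing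

search-Template : Searchable (Template k n)
search-Template = search-Vec (search-Maybe search-Fin) _

letter-fixed : ∀ (t : Template k n) {x a i} → lookup t x ≡ just a → lookup (instantiate t i) x ≡ a
letter-fixed t {x} {i = i} e = trans (lookup-map x (fromMaybe i) t) (cong (fromMaybe i) e)

letter-star : ∀ (t : Template k n) {x i} → lookup t x ≡ nothing → lookup (instantiate t i) x ≡ i
letter-star t {x} {i} e = trans (lookup-map x (fromMaybe i) t) (cong (fromMaybe i) e)

noStar-constant : ∀ (t : Template k n) → ¬ HasStar t → ∀ i i' → instantiate t i ≡ instantiate t i'
noStar-constant t noStar i i' = lookup-ext letter
  where
  letter : ∀ x → lookup (instantiate t i) x ≡ lookup (instantiate t i') x
  letter x with lookup t x in eq
  ... | just a = trans (letter-fixed t eq) (sym (letter-fixed t eq))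
  ... | nothing = contradiction (x , eq) noStar

starred-isLine : ∀ (t : Template k n) → HasStar t → IsLine k n (instantiate t)
starred-isLine {k} {n} t (x , star) = record { distinct = distinct ; columns = column }
  where
  distinct : ∀ i i' → instantiate t i ≡ instantiate t i' → i ≡ i'
  distinct i i' e = trans (sym (letter-star t star))
                          (trans (cong (λ w → lookup w x) e) (letter-star t star))
  column : ∀ j → (∀ i i' → lookup (instantiate t i) j ≡ lookup (instantiate t i') j)
               ⊎ (∀ i → lookup (instantiate t i) j ≡ i)
  column j with lookup t j in eq
  ... | just a = inj₁ λ i i' → trans (letter-fixed t eq) (sym (letter-fixed t eq))
  ... | nothing = inj₂ λ i → letter-star t eq

lineTemplate : ∀ {row} → IsLine (2 + k) n row →
  Σ (Template (2 + k) n) λ t → HasStar t × (∀ i → instantiate t i ≡ row i)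
lineTemplate {k} {n} {row} line = t , star , fits
  where
  open IsLine line
  Column : Fin n → Set
  Column j = (∀ i i' → lookup (row i) j ≡ lookup (row i') j) ⊎ (∀ i → lookup (row i) j ≡ i)
  entry : ∀ j → Column j → Maybe (Fin (2 + k))
  entry j (inj₁ _) = just (lookup (row zero) j)
  entry j (inj₂ _) = nothing
  entry-fits : ∀ j (c : Column j) i → fromMaybe i (entry j c) ≡ lookup (row i) j
  entry-fits j (inj₁ constant) i = constant zero i
  entry-fits j (inj₂ identity) i = sym (identity i)
  t : Template (2 + k) n
  t = tabulate λ j → entry j (columns j)
  fits : ∀ i → instantiate t i ≡ row i
  fits i = lookup-ext λ j → trans (lookup-map j (fromMaybe i) t)
    (trans (cong (fromMaybe i) (lookup∘tabulate _ j)) (entry-fits j (columns j) i))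
  -- Without a star, rows 0 and 1 would coincide.
  star : HasStar t
  star = decidable-stable (hasStar? t) λ noStar →
    contradiction (distinct zero (suc zero) (begin
      row zero                 ≡⟨ fits zero ⟨
      instantiate t zero       ≡⟨ noStar-constant t noStar zero (suc zero) ⟩
      instantiate t (suc zero) ≡⟨ fits (suc zero) ⟩
      row (suc zero)           ∎)) λ ()
    where open ≡-Reasoning

containsLine⇔ : ∀ {ws : List (Word (2 + k) n)} →
  ContainsLine (2 + k) n ws ⇔ (∃ λ t → HasStar t × ∀ i → instantiate t i ∈ₗ ws)
containsLine⇔ {ws = ws} =
  mk⇔ (λ (row , line , row∈) → let (t , star , fits) = lineTemplate line in
                                 t , star , λ i → subst (_∈ₗ ws) (sym (fits i)) (row∈ i))
      (λ (t , star , inst∈) → instantiate t , starred-isLine t star , inst∈)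

ProperColoring : (Word k n → Fin m) → Set
ProperColoring col =
  ∀ t → HasStar t → ¬ (∀ i i' → col (instantiate t i) ≡ col (instantiate t i'))

lineColorable⇔ : LineColorable (2 + k) n m ⇔ (∃ λ col → ProperColoring col)
lineColorable⇔ =
  mk⇔ (λ (col , good) → col , λ t star → good (instantiate t) (starred-isLine t star))
      (λ (col , proper) → col , λ row line mono →
         let (t , star , fits) = lineTemplate line in
         proper t star λ i i' →
           trans (cong col (fits i)) (trans (mono i i') (sym (cong col (fits i')))))

-- Lemma A: cylinder intersections in Part⁻¹(1) contain no line

fixedAt? : (t : Template k n) → ∀ x j → Dec (lookup t x ≡ just j)
fixedAt? t x j = ≡-decMaybe _≟_ (lookup t x) (just j)

fixedSets : Template k n → Tuple n k
fixedSets t = tupleOf (fixedAt? t)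

-- Off coordinate i, fixedSets t agrees with the level sets of the i-th
-- instantiation: for j ≢ i, the letter j occurs exactly where t fixes it.
fixedSets-agrees : (t : Template k n) → ∀ i → AgreeExcept i (levelSets (instantiate t i)) (fixedSets t)
fixedSets-agrees t i j j≢i = subset-ext λ x →
  ⇔.trans (∈-levelSets (instantiate t i)) (⇔.trans (letter⇔ x) (⇔.sym (∈-tupleOf (fixedAt? t))))
  where
  letter⇔ : ∀ x → lookup (instantiate t i) x ≡ j ⇔ lookup t x ≡ just j
  letter⇔ x with lookup t x in eq
  ... | just a = mk⇔ (λ e → cong just (trans (sym (letter-fixed t eq)) e))
                     (λ e → trans (letter-fixed t eq) (just-injective e))
  ... | nothing = mk⇔ (λ e → contradiction (trans (sym (letter-star t eq)) e) (j≢i ∘ sym)) λ ()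

fixedSets-uncovered : ∀ (t : Template k n) {x j} →
  lookup t x ≡ nothing → ¬ x ∈ₛ lookup (fixedSets t) j
fixedSets-uncovered t star x∈j =
  contradiction (trans (sym star) (to (∈-tupleOf (fixedAt? t)) x∈j)) λ ()

-- C contains fixedSets t, because each of its cylinders C_i
-- contains the i-th instantiation and ignores coordinate i; but fixedSets t
-- does not cover the star, so it is not a partition.
noLineInCylInt : (C : CylInt n k) → (∀ S → S ∈CI C → Part n k S) →
  ∀ t → HasStar t → ¬ (∀ i → levelSets (instantiate t i) ∈CI C)
noLineInCylInt C C⊆Part t (x , star) line =
  let (j , x∈j) = proj₂ (C⊆Part (fixedSets t) fixed∈C) x in fixedSets-uncovered t star x∈j
  where
  fixed∈C : fixedSets t ∈CI C
  fixed∈C i = trans (sym (CylInt.isCyl C i _ _ (fixedSets-agrees t i))) (line i i)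

-- Lemma B: the level sets of a line-free set form a cylinder intersection

agree-∈ : ∀ (w : Word k n) T {i j x} → AgreeExcept i (levelSets w) T → j ≢ i →
  x ∈ₛ lookup T j ⇔ lookup w x ≡ j
agree-∈ w T {x = x} agree j≢i = subst (λ s → x ∈ₛ s ⇔ _) (agree _ j≢i) (∈-levelSets w)

agreeExcept? : ∀ i (S T : Tuple n k) → Dec (AgreeExcept i S T)
agreeExcept? i S T = all? λ j → ¬? (j ≟ i) →-dec ≡-decVec _≟B_ (lookup S j) (lookup T j)

third : (a b : Fin (3 + k)) → ∃ λ c → c ≢ a × c ≢ b
third zero zero = suc zero , (λ ()) , (λ ())
third zero (suc zero) = suc (suc zero) , (λ ()) , (λ ())
third zero (suc (suc _)) = suc zero , (λ ()) , (λ ())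
third (suc zero) zero = suc (suc zero) , (λ ()) , (λ ())
third (suc zero) (suc _) = zero , (λ ()) , (λ ())
third (suc (suc _)) zero = suc zero , (λ ()) , (λ ())
third (suc (suc _)) (suc _) = zero , (λ ()) , (λ ())

module LineFreeCylinders {k n} (D : Word (3 + k) n → Set) (D? : Decidable D)
  (lineFree : ∀ {t} → HasStar t → ¬ (∀ i → D (instantiate t i))) where

  Near : Fin (3 + k) → Tuple n (3 + k) → Set
  Near i T = ∃ λ w → D w × AgreeExcept i (levelSets w) T

  near? : ∀ i T → Dec (Near i T)
  near? i T = search-Vec search-Fin n λ w → D? w ×-dec agreeExcept? i (levelSets w) T

  -- Near i is a cylinder in coordinate i since AgreeExcept i is transitive.
  cylinders : CylInt n (3 + k)
  cylinders = record { cyl = λ i T → does (near? i T) ; isCyl = isCyl }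
    where
    shift : ∀ {i} S T → AgreeExcept i S T → Near i S → Near i T
    shift S T S≈T (w , d , agree) = w , d , λ j j≢i → trans (agree j j≢i) (S≈T j j≢i)
    isCyl : ∀ i → IsCylinder i (λ T → does (near? i T))
    isCyl i S T S≈T =
      does-⇔ (mk⇔ (shift S T S≈T) (shift T S λ j j≢i → sym (S≈T j j≢i))) (near? i S) (near? i T)

  levelSets∈cylinders : ∀ {w} → D w → levelSets w ∈CI cylinders
  levelSets∈cylinders {w} d i = dec-true (near? i (levelSets w)) (w , d , λ _ _ → refl)

  -- A tuple S in all cylinders, with witnesses w i ∈ D agreeing with S off
  -- coordinate i: every witness spells the template of S, so they form a
  -- line unless they are all equal, in which case S is their level sets.
  module _ (S : Tuple n (3 + k)) (S∈ : S ∈CI cylinders) where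

    witness : Fin (3 + k) → Word (3 + k) n
    witness i = proj₁ (does⇒ (near? i S) (S∈ i))

    witness∈D : ∀ i → D (witness i)
    witness∈D i = proj₁ (proj₂ (does⇒ (near? i S) (S∈ i)))

    witness-agrees : ∀ i → AgreeExcept i (levelSets (witness i)) S
    witness-agrees i = proj₂ (proj₂ (does⇒ (near? i S) (S∈ i)))

    S⇔witness : ∀ i {j x} → j ≢ i → x ∈ₛ lookup S j ⇔ lookup (witness i) x ≡ j
    S⇔witness i = agree-∈ (witness i) S (witness-agrees i)

    -- If x ∈ S_j then every witness has letter j at x; for i = j this uses a
    -- third letter c, whose witness sees both x ∈ S_j and x ∈ S_{w_j(x)}.
    letter-in-part : ∀ i {j x} → x ∈ₛ lookup S j → lookup (witness i) x ≡ j
    letter-in-part i {j} {x} x∈j with j ≟ i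
    ... | no j≢i = to (S⇔witness i j≢i) x∈j
    ... | yes refl with lookup (witness j) x ≟ j
    ...   | yes wx≡j = wx≡j
    ...   | no wx≢j =
      let b = lookup (witness j) x
          x∈b = from (S⇔witness j wx≢j) refl
          (c , c≢j , c≢b) = third j b
      in contradiction (trans (sym (to (S⇔witness c (c≢b ∘ sym)) x∈b))
                              (to (S⇔witness c (c≢j ∘ sym)) x∈j)) wx≢j

    letter-outside : ∀ i {x} → (∀ j → ¬ x ∈ₛ lookup S j) → lookup (witness i) x ≡ i
    letter-outside i {x} outside with lookup (witness i) x ≟ i
    ... | yes wx≡i = wx≡i
    ... | no wx≢i = contradiction (from (S⇔witness i wx≢i) refl) (outside _)

    template : Template (3 + k) n
    template = tabulate (partOf S)

    witness-template : ∀ i → witness i ≡ instantiate template i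
    witness-template i = lookup-ext λ x →
      trans (letter x) (sym (trans (lookup-map x (fromMaybe i) template)
                                   (cong (fromMaybe i) (lookup∘tabulate _ x))))
      where
      letter : ∀ x → lookup (witness i) x ≡ fromMaybe i (partOf S x)
      letter x with partOf S x in eq
      ... | just j = letter-in-part i (partOf-just S eq)
      ... | nothing = letter-outside i λ j → partOf-nothing S eq

    -- A star would make the witnesses a line inside D; without one they all
    -- equal w_0, and S_j = (levelSets w_i)_j for any i ≢ j.
    ∈cylinders⇒levelSets : ∃ λ w → D w × S ≡ levelSets w
    ∈cylinders⇒levelSets with hasStar? template
    ... | yes star = ⊥-elim (lineFree star λ i → subst D (witness-template i) (witness∈D i))
    ... | no noStar = witness zero , witness∈D zero , lookup-ext λ j →
      let (i , i≢j , _) = third j j in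
      trans (sym (witness-agrees i j (i≢j ∘ sym))) (cong (λ w → lookup (levelSets w) j) (same i))
      where
      same : ∀ i → witness i ≡ witness zero
      same i = trans (witness-template i)
                     (trans (noStar-constant template noStar i zero) (sym (witness-template zero)))

  cylinders⊆Part : ∀ S → S ∈CI cylinders → Part n (3 + k) S
  cylinders⊆Part S S∈ with ∈cylinders⇒levelSets S S∈
  ... | w , _ , refl = levelSets-Part w

_∈?_ : (w : Word k n) (ws : List (Word k n)) → Dec (w ∈ₗ ws)
_∈?_ = DecMembership._∈?_ (≡-decVec _≟_)

lineFree⇒cylInt : LineFreeOfSize (3 + k) n m → CylIntInPartOfSize n (3 + k) m
lineFree⇒cylInt (ws , u , len , noLine) =
  cylinders , cylinders⊆Part , List.map levelSets ws , map⁺ levelSets-injective u ,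
  trans (length-map levelSets ws) len , λ S → mk⇔ (listed S) (inCylinders S)
  where
  open LineFreeCylinders (_∈ₗ ws) (_∈? ws)
    (λ star inst∈ → noLine (from containsLine⇔ (_ , star , inst∈)))
  listed : ∀ S → S ∈CI cylinders → S ∈ₗ List.map levelSets ws
  listed S S∈ with ∈cylinders⇒levelSets S S∈
  ... | w , w∈ , refl = ∈-map⁺ levelSets w∈
  inCylinders : ∀ S → S ∈ₗ List.map levelSets ws → S ∈CI cylinders
  inCylinders S S∈ with ∈-map⁻ levelSets S∈
  ... | w , w∈ , refl = levelSets∈cylinders w∈

cylInt⇒lineFree : CylIntInPartOfSize n (2 + k) m → LineFreeOfSize (2 + k) n m
cylInt⇒lineFree {n} {k} (C , C⊆Part , Ss , u , len , members) =
  List.map word Ss , map⁻ (subst Unique (sym roundtrip) u) ,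
  trans (length-map word Ss) len , noLine
  where
  inPart : ∀ {S} → S ∈ₗ Ss → Part n (2 + k) S
  inPart S∈ = C⊆Part _ (from (members _) S∈)
  -- Each listed tuple is a partition, hence the level sets of its word.
  roundtrip : List.map levelSets (List.map word Ss) ≡ Ss
  roundtrip = trans (sym (map-∘ Ss)) (map-id-local (All.tabulate λ S∈ → levelSets-word (inPart S∈)))
  noLine : ¬ ContainsLine (2 + k) n (List.map word Ss)
  noLine line =
    let (t , star , inst∈) = to containsLine⇔ line in
    noLineInCylInt C C⊆Part t star λ i →
      let (S , S∈ , e) = ∈-map⁻ word (inst∈ i) in
      from (members _) (subst (_∈ₗ Ss) (sym (trans (cong levelSets e) (levelSets-word (inPart S∈)))) S∈)

cover⇒coloring : PartCoverOfSize n (2 + k) m → LineColorable (2 + k) n m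
cover⇒coloring {n} {k} {m} (C , C⊆Part , covers , _) = from lineColorable⇔ (color , proper)
  where
  color : Word (2 + k) n → Fin m
  color w = proj₁ (covers (levelSets w) (levelSets-Part w))
  proper : ProperColoring color
  proper t star mono =
    noLineInCylInt (C (color (instantiate t zero))) (C⊆Part _) t star λ i →
      subst (λ r → levelSets (instantiate t i) ∈CI C r) (mono i zero) (proj₂ (covers _ _))

coloring⇒cover : LineColorable (3 + k) n m → PartCoverOfSize n (3 + k) m
coloring⇒cover {k} {n} {m} colorable with to lineColorable⇔ colorable
... | color , proper = Class.cylinders , Class.cylinders⊆Part , covers , disjoint
  where
  module Class (r : Fin m) = LineFreeCylinders (λ w → color w ≡ r) (λ w → color w ≟ r)
    (λ star same → proper _ star λ i i' → trans (same i) (sym (same i')))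
  covers : ∀ S → Part n (3 + k) S → ∃ λ r → S ∈CI Class.cylinders r
  covers S partS = color (word S) ,
    subst (_∈CI Class.cylinders (color (word S))) (levelSets-word partS)
          (Class.levelSets∈cylinders _ refl)
  disjoint : ∀ r r' S → S ∈CI Class.cylinders r → S ∈CI Class.cylinders r' → r ≡ r'
  disjoint r r' S S∈r S∈r'
    with Class.∈cylinders⇒levelSets r S S∈r | Class.∈cylinders⇒levelSets r' S S∈r'
  ... | w , refl , refl | w' , refl , e = cong color (levelSets-injective e)

containsLine? : (ws : List (Word (2 + k) n)) → Dec (ContainsLine (2 + k) n ws)
containsLine? ws = map′ (from containsLine⇔) (to containsLine⇔)
  (search-Template λ t → hasStar? t ×-dec all? λ i → instantiate t i ∈? ws)

LineFreeList : ∀ k n → List (Word k n) → Set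
LineFreeList k n ws = Unique ws × ¬ ContainsLine k n ws

lineFree⇔vector : LineFreeOfSize k n m ⇔ (∃ λ (v : Vec (Word k n) m) → LineFreeList k n (toList v))
lineFree⇔vector {k} {n} = mk⇔ asVector (λ (v , u , noLine) → toList v , u , length-toList v , noLine)
  where
  asVector : LineFreeOfSize k n m → ∃ λ (v : Vec (Word k n) m) → LineFreeList k n (toList v)
  asVector (ws , u , refl , noLine) =
    fromList ws , subst (LineFreeList k n) (sym (toList∘fromList ws)) (u , noLine)

lineFree? : ∀ m → Dec (LineFreeOfSize (2 + k) n m)
lineFree? {k} {n} m = map′ (from lineFree⇔vector) (to lineFree⇔vector)
  (search-Vec (search-Vec search-Fin n) m λ v →
     DecUnique.unique? (≡-decVec _≟_) (toList v) ×-dec ¬? (containsLine? (toList v)))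

lineFree-empty : LineFreeOfSize (suc k) n 0
lineFree-empty = List.[] , [] , refl , λ (row , _ , row∈) → contradiction (row∈ zero) λ ()

lineFree-bound : ∀ m → LineFreeOfSize k n m → m ≤ k ^ n
lineFree-bound _ (_ , u , refl , _) = unique-words-length u

properColoring? : (col : Word k n → Fin m) → Dec (ProperColoring col)
properColoring? col = search-∀ search-Template λ t →
  hasStar? t →-dec ¬? (all? λ i → all? λ i' → col (instantiate t i) ≟ col (instantiate t i'))

properColoring-cong : ∀ {col col' : Word k n → Fin m} →
  col ≗ col' → ProperColoring col → ProperColoring col'
properColoring-cong same proper t star mono =
  proper t star λ i i' → trans (same _) (trans (mono i i') (sym (same _)))

-- Colorings are searched as tables indexed by the codes of the words.
lineColorable? : ∀ m → Dec (LineColorable (2 + k) n m)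
lineColorable? {k} {n} m =
  map′ (λ (table , proper) → from lineColorable⇔ (lookup table ∘ code , proper)) asTable
       (search-Vec search-Fin _ λ table → properColoring? (lookup table ∘ code))
  where
  asTable : LineColorable (2 + k) n m →
    ∃ λ (table : Vec (Fin m) ((2 + k) ^ n)) → ProperColoring (lookup table ∘ code)
  asTable colorable =
    let (col , proper) = to lineColorable⇔ colorable in
    tabulate (col ∘ decode) ,
    properColoring-cong (λ w → sym (trans (lookup∘tabulate _ (code w)) (cong col (decode-code w))))
                        proper

-- Distinct words receive distinct codes, so k^n colors always suffice.
lineColorable-code : LineColorable (2 + k) n ((2 + k) ^ n)
lineColorable-code = code , λ row line mono →
  contradiction (IsLine.distinct line zero (suc zero) (code-injective (mono zero (suc zero)))) λ ()

theorem4 : ∀ (k n : ℕ) → 3 ≤ k → 1 ≤ n →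
    (Σ ℕ λ c → IsMax (LineFreeOfSize k n) c × IsMax (CylIntInPartOfSize n k) c)
    × (Σ ℕ λ χ → IsMin (PartCoverOfSize n k) χ × IsMin (LineColorable k n) χ)
theorem4 zero n () _
theorem4 (suc zero) n (s≤s ()) _
theorem4 (suc (suc zero)) n (s≤s (s≤s ())) _
theorem4 (suc (suc (suc k))) n _ _ =
  let (c , c-max) = boundedMaximum lineFree? lineFree-empty _ lineFree-bound
      (χ , χ-min) = leastElement lineColorable? _ lineColorable-code
  in (c , c-max , IsMax-transfer lineFree⇒cylInt cylInt⇒lineFree c-max)
   , (χ , IsMin-transfer coloring⇒cover cover⇒coloring χ-min , χ-min)
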